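{- Let $\mathcal M$ be an MMS, $Z$ a zone, $\vec x,\vec y\in\mathbb{R}^d$, $\rho,\rho'$ finite schedules, $\alpha>0$ and $\vec m\in\mathcal M$. (i) If $\vec x\xrightarrow{\rho(\alpha,\vec m)\rho'}_Z$, then $\vec x\xrightarrow{\rho(\frac{\alpha}{2},\vec m)\,\frac12\rho'\,(\frac{\alpha}{2},\vec m)}_Z$. (ii) If $\xrightarrow{\rho'(\alpha,\vec m)\rho}_Z\vec y$, then $\xrightarrow{(\frac{\alpha}{2},\vec m)\,\frac12\rho'\,(\frac{\alpha}{2},\vec m)\rho}_Z\vec y$.
   Context: A $d$-dimensional MMS is a finite set $\mathcal M\subseteq\mathbb{R}^d$ of modes. A (finite) schedule is a sequence $\pi=(\alpha_1,\vec m_1)\cdots(\alpha_k,\vec m_k)$ with $\alpha_i>0$, $\vec m_i\in\mathcal M$; concatenation of schedules is juxtaposition, and for $\lambda>0$, $\lambda\pi$ is $\pi$ with every $\alpha_i$ replaced by $\lambda\alpha_i$. From a point $\vec x_0$, $\pi$ induces the piecewise-linear execution $\sigma$ through $\vec x_j=\vec x_{j-1}+\alpha_j\vec m_j$, where on the time interval $[t_j,t_{j+1}]$ ($t_0=0$, $t_j=t_{j-1}+\alpha_j$) $\sigma(\tau)=\vec x_j+\frac{\tau-t_j}{\alpha_{j+1}}(\vec x_{j+1}-\vec x_j)$. A zone is a set $\{\vec x:A\vec x\le\vec b\}$ with integer $A,\vec b$. Notation: $\vec x\xrightarrow{\pi}_Z\vec y$ means that the execution induced by $\pi$ from $\vec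 x$ ends in $\vec y$ and $\sigma(\tau)\in Z$ for all $\tau$ in its domain; $\vec x\xrightarrow{\pi}_Z$ means $\vec x\xrightarrow{\pi}_Z\vec y$ for some $\vec y$; $\xrightarrow{\pi}_Z\vec y$ means $\vec z\xrightarrow{\pi}_Z\vec y$ for some $\vec z$. -}

module Defs where

open import Level using (0ℓ) renaming (suc to lsuc)
open import Algebra.Bundles using (CommutativeRing)
open import Relation.Binary.Core using (Rel)
open import Relation.Binary.Structures using (IsTotalOrder)
open import Relation.Nullary using (¬_)
open import Data.Nat using (ℕ; zero; suc)
open import Data.Integer using (ℤ; +_; -[1+_])
open import Data.Fin using (Fin; zero; suc)
open import Data.Product using (_×_; _,_; Σ; proj₁; proj₂)
open import Data.List using (List; []; _∷_; map)
open import Data.List.Relation.Unary.All using (All)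
open import Data.List.Membership.Propositional using (_∈_)

-- An ordered field (the statement is proved for every ordered field,
-- in particular for ℝ, which the standard library does not provide).
-- The inverse is total (0⁻¹ is an arbitrary junk value), as in Lean/Mathlib.
record OrderedField : Set₁ where
  field
    commutativeRing : CommutativeRing 0ℓ 0ℓ
  open CommutativeRing commutativeRing public
  field
    _≤_          : Rel Carrier 0ℓ
    isTotalOrder : IsTotalOrder _≈_ _≤_
    +-mono-≤     : ∀ {x y} z → x ≤ y → (x + z) ≤ (y + z)
    *-nonneg     : ∀ {x y} → 0# ≤ x → 0# ≤ y → 0# ≤ (x * y)
    0≉1          : ¬ (0# ≈ 1#)
    _⁻¹          : Carrier → Carrier
    ⁻¹-inverse   : ∀ x → ¬ (x ≈ 0#) → (x * (x ⁻¹)) ≈ 1#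

  _<_ : Rel Carrier 0ℓ
  x < y = (x ≤ y) × ¬ (x ≈ y)

  half : Carrier
  half = (1# + 1#) ⁻¹

module MMS (F : OrderedField) where
  open OrderedField F hiding (zero)

  fromℕ : ℕ → Carrier
  fromℕ zero    = 0#
  fromℕ (suc n) = 1# + fromℕ n

  fromℤ : ℤ → Carrier
  fromℤ (+ n)      = fromℕ n
  fromℤ -[1+ n ]   = - (1# + fromℕ n)

  Point : ℕ → Set
  Point d = Fin d → Carrier

  _+ᵥ_ : ∀ {d} → Point d → Point d → Point d
  (x +ᵥ y) i = x i + y i

  _-ᵥ_ : ∀ {d} → Point d → Point d → Point d
  (x -ᵥ y) i = x i - y i

  _·ᵥ_ : ∀ {d} → Carrier → Point d → Point d
  (c ·ᵥ x) i = c * x i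

  _≈ᵥ_ : ∀ {d} → Point d → Point d → Set
  x ≈ᵥ y = ∀ i → x i ≈ y i

  Σᶠ : ∀ {d} → (Fin d → Carrier) → Carrier
  Σᶠ {zero}  f = 0#
  Σᶠ {suc d} f = f zero + Σᶠ (λ i → f (suc i))

  -- an MMS: a finite set of modes, given as a list
  MMS : ℕ → Set
  MMS d = List (Point d)

  record Zone (d : ℕ) : Set where
    field
      rows : ℕ
      A    : Fin rows → Fin d → ℤ
      b    : Fin rows → ℤ

  _∈Z_ : ∀ {d} → Point d → Zone d → Set
  x ∈Z Z = ∀ i → Σᶠ (λ j → fromℤ (A i j) * x j) ≤ fromℤ (b i)
    where open Zone Z

  -- schedules: lists of (duration, mode)
  Schedule : ℕ → Set
  Schedule d = List (Carrier × Point d)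

  IsSchedule : ∀ {d} → MMS d → Schedule d → Set
  IsSchedule M π = All (λ s → (0# < proj₁ s) × (proj₂ s ∈ M)) π

  scale : ∀ {d} → Carrier → Schedule d → Schedule d
  scale c π = map (λ s → (c * proj₁ s , proj₂ s)) π

  -- Runs Z x π y  :  x --π-->_Z y.
  -- On the j-th piece, σ(τ) = x_j + s (x_{j+1} - x_j) with s = (τ - t_j)/α_{j+1} ∈ [0,1].
  -- For the empty schedule the domain is {0} and σ(0) = x.
  Runs : ∀ {d} → Zone d → Point d → Schedule d → Point d → Set
  Runs Z x []             y = (x ∈Z Z) × (x ≈ᵥ y)
  Runs Z x ((α , m) ∷ π)  y =
    (∀ s → 0# ≤ s → s ≤ 1# → ((x +ᵥ (s ·ᵥ ((x +ᵥ (α ·ᵥ m)) -ᵥ x))) ∈Z Z))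
    × Runs Z (x +ᵥ (α ·ᵥ m)) π y

-- Zones are convex. Hence, if σ is an execution inside a zone Z and c ∈ Z,
-- then τ ↦ (c + σ(2τ))/2 is again an execution inside Z, of the halved
-- schedule. For (i) let the step (α, m) run from p to p + αm and let ρ′
-- end in q. Averaging the step with its own start p gives the first half
-- step; averaging the execution of ρ′ with p gives ½ρ′ from p + (α/2)m to
-- (p + q)/2; averaging the step with q gives the last half step. (ii) is the
-- mirror image: average with the start z of ρ′ and with the end p + αm of
-- the step.

module Submission where

open import Level using (0ℓ)
open import Defs
open import Data.Nat using (ℕ; zero; suc)
open import Data.Fin using (zero; suc)
open import Data.Product using (_×_; _,_; Σ; proj₁)
open import Data.List using (_∷_; []; _++_)
open import Data.List.Membership.Propositional using (_∈_)
open import Data.Sum using (inj₁; inj₂)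
open import Relation.Nullary using (¬_)
open import Relation.Binary.Bundles using (Poset)
open import Relation.Binary.Structures using (IsTotalOrder)
import Relation.Binary.Reasoning.PartialOrder as ≤-Reasoning
import Algebra.Properties.Ring as RingProperties
import Algebra.Properties.AbelianGroup as AbelianGroupProperties
import Algebra.Solver.Ring.NaturalCoefficients.Default as SemiringSolver

module OrderedFieldProperties (F : OrderedField) where
  open OrderedField F hiding (zero) renaming (+-mono-≤ to +-monoˡ-≤)
  open RingProperties ring using (-‿distribˡ-*; -‿distribʳ-*; -‿involutive)

  module ≤ = IsTotalOrder isTotalOrder

  poset : Poset 0ℓ 0ℓ 0ℓ
  poset = record { isPartialOrder = ≤.isPartialOrder }

  open ≤-Reasoning poset

  +-mono-≤ : ∀ {x y u v} → x ≤ y → u ≤ v → (x + u) ≤ (y + v)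
  +-mono-≤ {x} {y} {u} {v} x≤y u≤v = begin
    x + u  ≤⟨ +-monoˡ-≤ u x≤y ⟩
    y + u  ≈⟨ +-comm y u ⟩
    u + y  ≤⟨ +-monoˡ-≤ y u≤v ⟩
    v + y  ≈⟨ +-comm v y ⟩
    y + v  ∎

  x≤y⇒0≤y-x : ∀ {x y} → x ≤ y → 0# ≤ (y - x)
  x≤y⇒0≤y-x {x} {y} x≤y = begin
    0#      ≈⟨ -‿inverseʳ x ⟨
    x - x   ≤⟨ +-monoˡ-≤ (- x) x≤y ⟩
    y - x   ∎

  x≤0⇒0≤-x : ∀ {x} → x ≤ 0# → 0# ≤ (- x)
  x≤0⇒0≤-x {x} x≤0 = ≤.≲-respʳ-≈ (+-identityˡ (- x)) (x≤y⇒0≤y-x x≤0)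

  *-monoʳ-≤-nonNeg : ∀ {c x y} → 0# ≤ c → x ≤ y → (c * x) ≤ (c * y)
  *-monoʳ-≤-nonNeg {c} {x} {y} 0≤c x≤y = begin
    c * x                   ≈⟨ +-identityˡ (c * x) ⟨
    0# + c * x              ≤⟨ +-monoˡ-≤ (c * x) (*-nonneg 0≤c (x≤y⇒0≤y-x x≤y)) ⟩
    c * (y - x) + c * x     ≈⟨ distribˡ c (y - x) x ⟨
    c * (y - x + x)         ≈⟨ *-congˡ (+-assoc y (- x) x) ⟩
    c * (y + (- x + x))     ≈⟨ *-congˡ (+-congˡ (-‿inverseˡ x)) ⟩
    c * (y + 0#)            ≈⟨ *-congˡ (+-identityʳ y) ⟩
    c * y                   ∎

  x*x-nonneg : ∀ x → 0# ≤ (x * x)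
  x*x-nonneg x with ≤.total 0# x
  ... | inj₁ 0≤x = *-nonneg 0≤x 0≤x
  ... | inj₂ x≤0 = begin
    0#            ≤⟨ *-nonneg (x≤0⇒0≤-x x≤0) (x≤0⇒0≤-x x≤0) ⟩
    - x * - x     ≈⟨ -‿distribˡ-* x (- x) ⟨
    - (x * - x)   ≈⟨ -‿cong (-‿distribʳ-* x x) ⟨
    - - (x * x)   ≈⟨ -‿involutive (x * x) ⟩
    x * x         ∎

  0≤1 : 0# ≤ 1#
  0≤1 = ≤.≲-respʳ-≈ (*-identityˡ 1#) (x*x-nonneg 1#)

  inverse-nonneg : ∀ {x y} → 0# ≤ x → (x * y) ≈ 1# → 0# ≤ y
  inverse-nonneg {x} {y} 0≤x xy≈1 = begin
    0#             ≤⟨ *-nonneg 0≤x (x*x-nonneg y) ⟩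
    x * (y * y)    ≈⟨ *-assoc x y y ⟨
    x * y * y      ≈⟨ *-congʳ xy≈1 ⟩
    1# * y         ≈⟨ *-identityˡ y ⟩
    y              ∎

  1≤2 : 1# ≤ (1# + 1#)
  1≤2 = ≤.≲-respˡ-≈ (+-identityˡ 1#) (+-monoˡ-≤ 1# 0≤1)

  2≉0 : ¬ (1# + 1# ≈ 0#)
  2≉0 2≈0 = 0≉1 (≤.antisym 0≤1 (≤.≲-respʳ-≈ 2≈0 1≤2))

  half-nonneg : 0# ≤ half
  half-nonneg = inverse-nonneg (≤.trans 0≤1 1≤2) (⁻¹-inverse (1# + 1#) 2≉0)

  half+half≈1 : half + half ≈ 1#
  half+half≈1 = begin-equality
    half + half               ≈⟨ +-cong (*-identityˡ half) (*-identityˡ half) ⟨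
    1# * half + 1# * half     ≈⟨ distribʳ half 1# 1# ⟨
    (1# + 1#) * half          ≈⟨ ⁻¹-inverse (1# + 1#) 2≉0 ⟩
    1#                        ∎

  half*x+half*x≈x : ∀ x → half * x + half * x ≈ x
  half*x+half*x≈x x = begin-equality
    half * x + half * x   ≈⟨ distribʳ x half half ⟨
    (half + half) * x     ≈⟨ *-congʳ half+half≈1 ⟩
    1# * x                ≈⟨ *-identityˡ x ⟩
    x                     ∎

module Geometry (F : OrderedField) where
  open OrderedField F hiding (zero; +-mono-≤)
  open MMS F
  open OrderedFieldProperties F
  open ≤-Reasoning poset
  open SemiringSolver commutativeSemiring
  open AbelianGroupProperties +-abelianGroup using (xyx⁻¹≈y)

  Σᶠ-cong : ∀ {d} {f g : Point d} → f ≈ᵥ g → Σᶠ f ≈ Σᶠ g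
  Σᶠ-cong {zero}  f≈g = refl
  Σᶠ-cong {suc d} f≈g = +-cong (f≈g zero) (Σᶠ-cong (λ j → f≈g (suc j)))

  Σᶠ-linear : ∀ {d} (f : Point d) a b (x y : Point d) →
    Σᶠ (λ j → f j * (a * x j + b * y j))
      ≈ a * Σᶠ (λ j → f j * x j) + b * Σᶠ (λ j → f j * y j)
  Σᶠ-linear {zero}  f a b x y =
    solve 2 (λ a b → con 0 := a :* con 0 :+ b :* con 0) refl a b
  Σᶠ-linear {suc d} f a b x y = begin-equality
    f zero * (a * x zero + b * y zero) + Σᶠ (λ j → f (suc j) * (a * x (suc j) + b * y (suc j)))
      ≈⟨ +-congˡ (Σᶠ-linear (λ j → f (suc j)) a b (λ j → x (suc j)) (λ j → y (suc j))) ⟩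
    f zero * (a * x zero + b * y zero) + (a * Sx + b * Sy)
      ≈⟨ solve 7 (λ f₀ a b x₀ y₀ Sx Sy →
                    f₀ :* (a :* x₀ :+ b :* y₀) :+ (a :* Sx :+ b :* Sy)
                      := a :* (f₀ :* x₀ :+ Sx) :+ b :* (f₀ :* y₀ :+ Sy))
                 refl (f zero) a b (x zero) (y zero) Sx Sy ⟩
    a * (f zero * x zero + Sx) + b * (f zero * y zero + Sy) ∎
    where
    Sx = Σᶠ (λ j → f (suc j) * x (suc j))
    Sy = Σᶠ (λ j → f (suc j) * y (suc j))

  ≈ᵥ-refl : ∀ {d} {x : Point d} → x ≈ᵥ x
  ≈ᵥ-refl i = refl

  ≈ᵥ-sym : ∀ {d} {x y : Point d} → x ≈ᵥ y → y ≈ᵥ x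
  ≈ᵥ-sym x≈y i = sym (x≈y i)

  midpoint : ∀ {d} → Point d → Point d → Point d
  midpoint c u = (half ·ᵥ c) +ᵥ (half ·ᵥ u)

  midpoint-comm : ∀ {d} (c u : Point d) → midpoint c u ≈ᵥ midpoint u c
  midpoint-comm c u i = +-comm (half * c i) (half * u i)

  midpoint-idem : ∀ {d} (c : Point d) → midpoint c c ≈ᵥ c
  midpoint-idem c i = half*x+half*x≈x (c i)

  module _ {d : ℕ} (Z : Zone d) where
    open Zone Z

    ∈Z-resp-≈ᵥ : ∀ {x y : Point d} → x ≈ᵥ y → x ∈Z Z → y ∈Z Z
    ∈Z-resp-≈ᵥ x≈y x∈Z i = ≤.≲-respˡ-≈ (Σᶠ-cong (λ j → *-congˡ (x≈y j))) (x∈Z i)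

    ∈Z-convex : ∀ {s t} {x y : Point d} → 0# ≤ s → 0# ≤ t → s + t ≈ 1# →
                x ∈Z Z → y ∈Z Z → ((s ·ᵥ x) +ᵥ (t ·ᵥ y)) ∈Z Z
    ∈Z-convex {s} {t} {x} {y} 0≤s 0≤t s+t≈1 x∈Z y∈Z i = begin
      Σᶠ (λ j → fromℤ (A i j) * (s * x j + t * y j))
        ≈⟨ Σᶠ-linear (λ j → fromℤ (A i j)) s t x y ⟩
      s * Σᶠ (λ j → fromℤ (A i j) * x j) + t * Σᶠ (λ j → fromℤ (A i j) * y j)
        ≤⟨ +-mono-≤ (*-monoʳ-≤-nonNeg 0≤s (x∈Z i)) (*-monoʳ-≤-nonNeg 0≤t (y∈Z i)) ⟩
      s * fromℤ (b i) + t * fromℤ (b i)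
        ≈⟨ distribʳ (fromℤ (b i)) s t ⟨
      (s + t) * fromℤ (b i)
        ≈⟨ *-congʳ s+t≈1 ⟩
      1# * fromℤ (b i)
        ≈⟨ *-identityˡ (fromℤ (b i)) ⟩
      fromℤ (b i) ∎

    ∈Z-midpoint : ∀ {c u : Point d} → c ∈Z Z → u ∈Z Z → midpoint c u ∈Z Z
    ∈Z-midpoint = ∈Z-convex half-nonneg half-nonneg half+half≈1

    SegmentIn : Point d → Point d → Set
    SegmentIn x v = ∀ s → 0# ≤ s → s ≤ 1# → (x +ᵥ (s ·ᵥ v)) ∈Z Z

    SegmentIn-resp-≈ᵥ : ∀ {x x′ v v′} → x ≈ᵥ x′ → v ≈ᵥ v′ → SegmentIn x v → SegmentIn x′ v′
    SegmentIn-resp-≈ᵥ x≈x′ v≈v′ seg s 0≤s s≤1 =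
      ∈Z-resp-≈ᵥ (λ i → +-cong (x≈x′ i) (*-congˡ (v≈v′ i))) (seg s 0≤s s≤1)

    SegmentIn-start : ∀ {x v} → SegmentIn x v → x ∈Z Z
    SegmentIn-start {x} {v} seg = ∈Z-resp-≈ᵥ x+0v≈x (seg 0# ≤.refl 0≤1)
      where
      x+0v≈x : (x +ᵥ (0# ·ᵥ v)) ≈ᵥ x
      x+0v≈x i = trans (+-congˡ (zeroˡ (v i))) (+-identityʳ (x i))

    SegmentIn-end : ∀ {x v} → SegmentIn x v → (x +ᵥ v) ∈Z Z
    SegmentIn-end {x} {v} seg = ∈Z-resp-≈ᵥ (λ i → +-congˡ (*-identityˡ (v i))) (seg 1# 0≤1 ≤.refl)

    SegmentIn-midpoint : ∀ {c u v} → c ∈Z Z → SegmentIn u v → SegmentIn (midpoint c u) (half ·ᵥ v)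
    SegmentIn-midpoint {c} {u} {v} c∈Z seg s 0≤s s≤1 =
      ∈Z-resp-≈ᵥ regroup (∈Z-midpoint c∈Z (seg s 0≤s s≤1))
      where
      regroup : midpoint c (u +ᵥ (s ·ᵥ v)) ≈ᵥ (midpoint c u +ᵥ (s ·ᵥ (half ·ᵥ v)))
      regroup i = solve 5 (λ h c u s v → h :* c :+ h :* (u :+ s :* v) := (h :* c :+ h :* u) :+ s :* (h :* v))
                    refl half (c i) (u i) s (v i)

    Runs-∷⁺ : ∀ {x y α m π} → SegmentIn x (α ·ᵥ m) → Runs Z (x +ᵥ (α ·ᵥ m)) π y →
              Runs Z x ((α , m) ∷ π) y
    Runs-∷⁺ {x} {α = α} {m} seg r = SegmentIn-resp-≈ᵥ ≈ᵥ-refl (λ i → sym (xyx⁻¹≈y (x i) (α * m i))) seg , r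

    Runs-∷⁻ : ∀ {x y} α m π → Runs Z x ((α , m) ∷ π) y →
              SegmentIn x (α ·ᵥ m) × Runs Z (x +ᵥ (α ·ᵥ m)) π y
    Runs-∷⁻ {x} α m π (seg , r) = SegmentIn-resp-≈ᵥ ≈ᵥ-refl (λ i → xyx⁻¹≈y (x i) (α * m i)) seg , r

    Runs-respˡ-≈ᵥ : ∀ {x x′ y} π → x ≈ᵥ x′ → Runs Z x π y → Runs Z x′ π y
    Runs-respˡ-≈ᵥ []            x≈x′ (x∈Z , x≈y) = ∈Z-resp-≈ᵥ x≈x′ x∈Z , λ i → trans (sym (x≈x′ i)) (x≈y i)
    Runs-respˡ-≈ᵥ ((α , m) ∷ π) x≈x′ r with Runs-∷⁻ α m π r
    ... | seg , r′ = Runs-∷⁺ (SegmentIn-resp-≈ᵥ x≈x′ ≈ᵥ-refl seg) (Runs-respˡ-≈ᵥ π (λ i → +-congʳ (x≈x′ i)) r′)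

    Runs-start : ∀ {x y} π → Runs Z x π y → x ∈Z Z
    Runs-start []            (x∈Z , _) = x∈Z
    Runs-start ((α , m) ∷ π) r         = SegmentIn-start (proj₁ (Runs-∷⁻ α m π r))

    Runs-end : ∀ {x y} π → Runs Z x π y → y ∈Z Z
    Runs-end []      (x∈Z , x≈y) = ∈Z-resp-≈ᵥ x≈y x∈Z
    Runs-end (_ ∷ π) (_ , r)     = Runs-end π r

    Runs-++⁻ : ∀ {x y} ρ σ → Runs Z x (ρ ++ σ) y → Σ (Point d) λ p → Runs Z x ρ p × Runs Z p σ y
    Runs-++⁻ []      σ r = _ , (Runs-start σ r , ≈ᵥ-refl) , r
    Runs-++⁻ (_ ∷ ρ) σ (seg , r) with Runs-++⁻ ρ σ r
    ... | p , r₁ , r₂ = p , (seg , r₁) , r₂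

    Runs-++⁺ : ∀ {x p y} ρ σ → Runs Z x ρ p → Runs Z p σ y → Runs Z x (ρ ++ σ) y
    Runs-++⁺ []      σ (_ , x≈p) r₂ = Runs-respˡ-≈ᵥ σ (≈ᵥ-sym x≈p) r₂
    Runs-++⁺ (_ ∷ ρ) σ (seg , r₁) r₂ = seg , Runs-++⁺ ρ σ r₁ r₂

    Runs-midpoint-∷ : ∀ {c u w α β m} π → c ∈Z Z → SegmentIn u (α ·ᵥ m) → β ≈ α * half →
                      Runs Z (midpoint c (u +ᵥ (α ·ᵥ m))) π w → Runs Z (midpoint c u) ((β , m) ∷ π) w
    Runs-midpoint-∷ {c} {u} {α = α} {β} {m} π c∈Z seg β≈α/2 r =
      Runs-∷⁺ (SegmentIn-resp-≈ᵥ ≈ᵥ-refl halve (SegmentIn-midpoint c∈Z seg))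
              (Runs-respˡ-≈ᵥ π regroup r)
      where
      halve : (half ·ᵥ (α ·ᵥ m)) ≈ᵥ (β ·ᵥ m)
      halve i = trans (solve 3 (λ h a m → h :* (a :* m) := (a :* h) :* m) refl half α (m i))
                      (*-congʳ (sym β≈α/2))
      regroup : midpoint c (u +ᵥ (α ·ᵥ m)) ≈ᵥ (midpoint c u +ᵥ (β ·ᵥ m))
      regroup i = trans (solve 5 (λ h c u a m → h :* c :+ h :* (u :+ a :* m) := (h :* c :+ h :* u) :+ h :* (a :* m))
                          refl half (c i) (u i) α (m i))
                        (+-congˡ (halve i))

    Runs-midpoint : ∀ {c u v} π → c ∈Z Z → Runs Z u π v → Runs Z (midpoint c u) (scale half π) (midpoint c v)
    Runs-midpoint []            c∈Z (u∈Z , u≈v) = ∈Z-midpoint c∈Z u∈Z , λ i → +-congˡ (*-congˡ (u≈v i))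
    Runs-midpoint ((α , m) ∷ π) c∈Z r with Runs-∷⁻ α m π r
    ... | seg , r′ = Runs-midpoint-∷ (scale half π) c∈Z seg (*-comm half α) (Runs-midpoint π c∈Z r′)

    split-step-around-following : ∀ {x} ρ ρ′ α m →
      (Σ (Point d) λ y → Runs Z x (ρ ++ (α , m) ∷ ρ′) y) →
      Σ (Point d) λ y → Runs Z x (ρ ++ (α * half , m) ∷ (scale half ρ′ ++ (α * half , m) ∷ [])) y
    split-step-around-following ρ ρ′ α m (q , x→q) with Runs-++⁻ ρ ((α , m) ∷ ρ′) x→q
    ... | p , x→p , p→q with Runs-∷⁻ α m ρ′ p→q
    ... | seg , p′→q =
      midpoint q p′ ,
      Runs-++⁺ ρ (step ∷ (scale half ρ′ ++ step ∷ [])) x→p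
        (Runs-respˡ-≈ᵥ (step ∷ (scale half ρ′ ++ step ∷ [])) (midpoint-idem p)
          (Runs-midpoint-∷ (scale half ρ′ ++ step ∷ []) p∈Z seg refl
            (Runs-++⁺ (scale half ρ′) (step ∷ []) (Runs-midpoint ρ′ p∈Z p′→q)
              (Runs-respˡ-≈ᵥ (step ∷ []) (midpoint-comm q p)
                (Runs-midpoint-∷ [] q∈Z seg refl
                  (Runs-midpoint [] q∈Z (SegmentIn-end seg , ≈ᵥ-refl)))))))
      where
      step : Carrier × Point d
      step = (α * half , m)
      p′ : Point d
      p′ = p +ᵥ (α ·ᵥ m)
      p∈Z : p ∈Z Z
      p∈Z = SegmentIn-start seg
      q∈Z : q ∈Z Z
      q∈Z = Runs-end ρ′ p′→q

    split-step-around-preceding : ∀ {y} ρ ρ′ α m →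
      (Σ (Point d) λ z → Runs Z z (ρ′ ++ (α , m) ∷ ρ) y) →
      Σ (Point d) λ z → Runs Z z ((α * half , m) ∷ (scale half ρ′ ++ (α * half , m) ∷ ρ)) y
    split-step-around-preceding ρ ρ′ α m (z , z→y) with Runs-++⁻ ρ′ ((α , m) ∷ ρ) z→y
    ... | p , z→p , p→y with Runs-∷⁻ α m ρ p→y
    ... | seg , p′→y =
      midpoint z p ,
      Runs-midpoint-∷ (scale half ρ′ ++ step ∷ ρ) z∈Z seg refl
        (Runs-respˡ-≈ᵥ (scale half ρ′ ++ step ∷ ρ) (midpoint-comm p′ z)
          (Runs-++⁺ (scale half ρ′) (step ∷ ρ) (Runs-midpoint ρ′ p′∈Z z→p)
            (Runs-midpoint-∷ ρ p′∈Z seg refl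
              (Runs-respˡ-≈ᵥ ρ (≈ᵥ-sym (midpoint-idem p′)) p′→y))))
      where
      step : Carrier × Point d
      step = (α * half , m)
      p′ : Point d
      p′ = p +ᵥ (α ·ᵥ m)
      z∈Z : z ∈Z Z
      z∈Z = Runs-start ρ′ z→p
      p′∈Z : p′ ∈Z Z
      p′∈Z = SegmentIn-end seg

lemma2 : (F : OrderedField) → let open OrderedField F hiding (zero) in let open MMS F in
    ∀ {d : ℕ} (M : MMS d) (Z : Zone d) (x y : Point d) (ρ ρ′ : Schedule d)
      (α : Carrier) (m : Point d) →
      IsSchedule M ρ → IsSchedule M ρ′ → 0# < α → m ∈ M →
      ((Σ (Point d) λ y₁ → Runs Z x (ρ ++ (α , m) ∷ ρ′) y₁) →
        Σ (Point d) λ y₁ → Runs Z x (ρ ++ (α * half , m) ∷ (scale half ρ′ ++ (α * half , m) ∷ [])) y₁)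
      × ((Σ (Point d) λ z → Runs Z z (ρ′ ++ (α , m) ∷ ρ) y) →
        Σ (Point d) λ z → Runs Z z ((α * half , m) ∷ (scale half ρ′ ++ (α * half , m) ∷ ρ)) y)
lemma2 F M Z x y ρ ρ′ α m _ _ _ _ =
  split-step-around-following Z ρ ρ′ α m , split-step-around-preceding Z ρ ρ′ α m
  where open Geometry F
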